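{- Let $k>0$ and $\alpha=(\alpha_1,\dots,\alpha_r)\in[k]^r$ with $\alpha_1+\cdots+\alpha_r=n$. Then $|\mathcal{M}_{\alpha,k}|=|\mathcal{OP}_{\alpha,k}|$.
   Context: For $S=\{s_1<\cdots<s_t\}\subseteq[n]$ the skip sequence $\gamma(S)=(\gamma_1,\dots,\gamma_n)$ has $\gamma_i=i-j+1$ if $i=s_j$ and $\gamma_i=0$ if $i\notin S$; the reverse skip monomial is $\mathbf{x}(S)^*=x_1^{\gamma_n}\cdots x_n^{\gamma_1}$. A monomial $m\in\mathbb{Q}[x_1,\dots,x_n]$ is $\alpha$-nonskip if $\mathbf{x}(S)^*\nmid m$ for every $S\subseteq[n]$ with $|S|=n-k+1$, and $x_{\alpha_1+\cdots+\alpha_{i-1}+j}^{k-j+1}\nmid m$ for all $1\le i\le r$, $1\le j\le\alpha_i$; $\mathcal{M}_{\alpha,k}$ is the set of $\alpha$-nonskip monomials. An ordered set partition of $[n]$ with $k$ blocks is a sequence $(B_1\mid\cdots\mid B_k)$ of nonempty pairwise disjoint sets with union $[n]$. $\mathcal{OP}_{\alpha,k}$ is the set of such ordered set partitions in which, for each $1\le i\le r$, the letters of the $i$-th batch $\alpha_1+\cdots+\alpha_{i-1}+1,\dots,\alpha_1+\cdots+\alpha_i$ lie in distinct blocks. -}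

module Defs where

open import Data.Nat using (ℕ; zero; suc; _+_; _∸_; _≤_; _<_)
open import Data.Nat.Properties using (_≤?_)
open import Data.Bool using (Bool; true; false; if_then_else_)
open import Data.Fin using (Fin; toℕ; opposite) renaming (zero to fzero; suc to fsuc)
open import Data.Fin.Properties using () renaming (_≤?_ to _≤ᶠ?_)
open import Data.Fin.Subset using (Subset; _∈_; _∩_; ∣_∣; Nonempty; Empty)
open import Data.Vec using (Vec; []; _∷_; lookup; tabulate)
open import Data.List using (List; length)
open import Data.List.Membership.Propositional using () renaming (_∈_ to _∈ₗ_)
open import Data.List.Relation.Unary.Unique.Propositional using (Unique)
open import Data.Product using (Σ; ∃; _×_)
open import Relation.Nullary using (¬_)
open import Relation.Nullary.Decidable using (⌊_⌋)
open import Relation.Binary.PropositionalEquality using (_≡_; _≢_)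
open import Function.Bundles using (_⇔_)

-- Convention: variables x_1..x_n are indexed by p : Fin n (p ↔ x_{toℕ p + 1}).
-- A monomial is its exponent vector: entry p = exponent of x_{toℕ p + 1}.
Monomial : ℕ → Set
Monomial n = Vec ℕ n

_∣ₘ_ : ∀ {n} → Monomial n → Monomial n → Set
m₁ ∣ₘ m₂ = ∀ p → lookup m₁ p ≤ lookup m₂ p

powDivides : ∀ {n} → Fin n → ℕ → Monomial n → Set
powDivides p e m = e ≤ lookup m p

-- rank S p = j such that (p+1) = s_j, i.e. |{ q ∈ S : q ≤ p }|
rank : ∀ {n} → Subset n → Fin n → ℕ
rank S p = ∣ S ∩ tabulate (λ q → ⌊ q ≤ᶠ? p ⌋) ∣

-- skip sequence γ(S): γ_i = i - j + 1 if i = s_j, 0 if i ∉ S  (entry p is γ_{toℕ p + 1})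
skipSeq : ∀ {n} → Subset n → Vec ℕ n
skipSeq S = tabulate (λ p → if lookup S p then suc (toℕ p) ∸ rank S p + 1 else 0)

-- reverse skip monomial x(S)* = x_1^{γ_n} ⋯ x_n^{γ_1}
revSkipMonomial : ∀ {n} → Subset n → Monomial n
revSkipMonomial S = tabulate (λ p → lookup (skipSeq S) (opposite p))

-- α_1 + ⋯ + α_{i-1}  (i : Fin r, 0-indexed)
offset : ∀ {r} → Vec ℕ r → Fin r → ℕ
offset (a ∷ as) fzero = 0
offset (a ∷ as) (fsuc i) = a + offset as i

NonSkip : ∀ {r} (α : Vec ℕ r) (n k : ℕ) → Monomial n → Set
NonSkip α n k m =
  (∀ (S : Subset n) → ∣ S ∣ ≡ n ∸ k + 1 → ¬ (revSkipMonomial S ∣ₘ m))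
  × (∀ (i : Fin _) (j : ℕ) (p : Fin n) → 1 ≤ j → j ≤ lookup α i →
       suc (toℕ p) ≡ offset α i + j → ¬ powDivides p (k ∸ j + 1) m)

OrderedSetPartition : ℕ → ℕ → Set
OrderedSetPartition n k = Vec (Subset n) k

IsOSP : ∀ {n k} → OrderedSetPartition n k → Set
IsOSP {n} {k} B =
  (∀ (a : Fin k) → Nonempty (lookup B a))
  × (∀ (a b : Fin k) → a ≢ b → Empty (lookup B a ∩ lookup B b))
  × (∀ (p : Fin n) → ∃ λ (a : Fin k) → p ∈ lookup B a)

-- letter p (i.e. toℕ p + 1) belongs to the i-th batch
InBatch : ∀ {r n} → Vec ℕ r → Fin r → Fin n → Set
InBatch α i p = offset α i < suc (toℕ p) × suc (toℕ p) ≤ offset α i + lookup α i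

IsOP : ∀ {r} (α : Vec ℕ r) (n k : ℕ) → OrderedSetPartition n k → Set
IsOP α n k B =
  IsOSP B
  × (∀ (i : Fin _) (p q : Fin n) → InBatch α i p → InBatch α i q → p ≢ q →
       ∀ (a : Fin k) → ¬ (p ∈ lookup B a × q ∈ lookup B a))

HasCard : {A : Set} → (A → Set) → ℕ → Set
HasCard {A} P c =
  Σ (List A) λ xs → Unique xs × (∀ x → (x ∈ₗ xs) ⇔ P x) × length xs ≡ c

module Submission where

-- Both sets are listed without repetition, and the two lists are shown to
-- have the same length by a common recursion.
--  * Monomials.  Read the exponents from x_n down to x_1 with a greedy
--    counter that starts at 0 and goes up by one at every exponent not
--    exceeding its current value.  Choosing the skipped positions greedily
--    shows that no x(S)* with |S| = n - k + 1 divides m iff the counter ends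
--    at least at k; the batch condition bounds the exponent of the letter in
--    position t of its batch strictly by k - t.
--  * Partitions.  An ordered set partition is a surjective colouring of [n]
--    by block indices; the batch condition says that, reading the word
--    backwards, each letter avoids the colours of the t letters before it in
--    its batch (its window).
--  * Counting.  Splitting on the first entry, vectors below (k - w_q)_q whose
--    counter started at c reaches k, and window-respecting colourings missing
--    at most c colours, both satisfy
--      N(w ∷ s, c) = (k - w) · N(s, c) + (c + 1) · #(colourings missing c + 1).

open import Defs
open import Data.Nat using (ℕ; zero; suc; _+_; _*_; _∸_; _⊓_; _≤_; _<_; z≤n; s≤s; _≤ᵇ_; _<ᵇ_)
open import Data.Nat.Properties
open import Data.Nat.Tactic.RingSolver using (solve-∀)
open import Algebra.Properties.CommutativeSemigroup +-commutativeSemigroup using (x∙yz≈y∙xz)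
open import Data.Fin using (Fin; toℕ; opposite) renaming (zero to fzero; suc to fsuc; _≟_ to _≟ᶠ_)
open import Data.Fin.Properties
  using (toℕ<n; toℕ-injective; toℕ-fromℕ; opposite-prop; opposite-suc; opposite-involutive)
  renaming (_≤?_ to _≤ᶠ?_)
open import Data.Fin.Subset using (Subset; _∩_; ∣_∣) renaming (_∈_ to _∈ₛ_)
open import Data.Fin.Subset.Properties using (∣⊥∣≡0; x∈p∩q⁺; x∈p∩q⁻)
open import Data.Vec using (Vec; []; _∷_; lookup; tabulate; replicate; toList; sum)
import Data.Vec as Vec
open import Data.Vec.Properties
  using (∷-injective; length-toList; lookup∘tabulate; tabulate-cong; tabulate∘lookup; lookup-replicate;
         lookup-map; []=⇒lookup; lookup⇒[]=)
open import Data.List using (List; []; _∷_; _++_; map; length; filter; allFin; take; concatMap; downFrom)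
open import Data.List.Properties using (length-++; length-map; length-take; length-tabulate; filter-all)
open import Data.List.Membership.Propositional using (_∈_; _∉_; find; lose)
open import Data.List.Membership.Propositional.Properties
  using (∈-concatMap⁺; ∈-concatMap⁻; ∈-map⁺; ∈-map⁻; ∈-filter⁺; ∈-filter⁻; ∈-allFin; ∈-++⁺ˡ; ∈-++⁺ʳ;
         ∈-downFrom⁺; ∈-downFrom⁻)
open import Data.List.Membership.Propositional.Properties.WithK using (unique∧set⇒bag)
open import Data.List.Relation.Binary.BagAndSetEquality using (∼bag⇒↭)
open import Data.List.Relation.Binary.Permutation.Propositional.Properties using (↭-length)
open import Data.List.Relation.Unary.Unique.Propositional using (Unique)
open import Data.List.Relation.Unary.Unique.Propositional.Properties
  using (++⁺; map⁺; filter⁺; allFin⁺; downFrom⁺)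
open import Data.List.Relation.Unary.AllPairs using ([]; _∷_)
open import Data.List.Relation.Unary.All as All using ([])
open import Data.List.Relation.Unary.Any using (here; there)
open import Data.Bool using (Bool; true; false; if_then_else_)
open import Data.Unit using (⊤; tt)
open import Data.Product using (Σ; ∃; _×_; _,_; proj₁; proj₂)
open import Data.Sum as Sum using (_⊎_; inj₁; inj₂; [_,_]′)
open import Data.Empty using (⊥; ⊥-elim)
open import Level using (0ℓ)
open import Relation.Nullary using (¬_; Dec; yes; no; does; contradiction; _×-dec_)
open import Relation.Nullary.Decidable using (⌊_⌋; isYes≗does; dec-true)
open import Relation.Unary using (Pred; Decidable)
open import Relation.Binary.Definitions using (tri<; tri≈; tri>)
open import Relation.Binary.PropositionalEquality
open import Function using (_∘_; id)
open import Function.Bundles using (_⇔_; mk⇔; Equivalence)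

length-unique : ∀ {A : Set} {xs ys : List A} → Unique xs → Unique ys →
                (∀ {x} → x ∈ xs ⇔ x ∈ ys) → length xs ≡ length ys
length-unique u v e = ↭-length (∼bag⇒↭ (unique∧set⇒bag u v e))

module _ {A B : Set} (f : A → List B) where

  ∈-concatMap-intro : ∀ {xs x y} → x ∈ xs → y ∈ f x → y ∈ concatMap f xs
  ∈-concatMap-intro x∈ y∈ = ∈-concatMap⁺ f (lose x∈ y∈)

  ∈-concatMap-elim : ∀ {xs y} → y ∈ concatMap f xs → ∃ λ x → x ∈ xs × y ∈ f x
  ∈-concatMap-elim y∈ = find (∈-concatMap⁻ f y∈)

  unique-concatMap : ∀ {xs} → Unique xs → (∀ x → Unique (f x)) →
                     (∀ {x x' y} → y ∈ f x → y ∈ f x' → x ≡ x') →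
                     Unique (concatMap f xs)
  unique-concatMap {[]} [] _ _ = []
  unique-concatMap {x ∷ xs} (x∉xs ∷ u) uf determines =
    ++⁺ (uf x) (unique-concatMap u uf determines) λ (y∈fx , y∈rest) →
      let (x' , x'∈xs , y∈fx') = ∈-concatMap-elim y∈rest
      in All.lookup x∉xs x'∈xs (determines y∈fx y∈fx')

sumOver : ∀ {A : Set} → (A → ℕ) → List A → ℕ
sumOver w [] = 0
sumOver w (x ∷ xs) = w x + sumOver w xs

sumOver-cong : ∀ {A : Set} {v w : A → ℕ} xs → (∀ x → v x ≡ w x) → sumOver v xs ≡ sumOver w xs
sumOver-cong [] _ = refl
sumOver-cong (x ∷ xs) v≗w = cong₂ _+_ (v≗w x) (sumOver-cong xs v≗w)

length-concatMap : ∀ {A B : Set} (f : A → List B) xs →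
                   length (concatMap f xs) ≡ sumOver (λ x → length (f x)) xs
length-concatMap f [] = refl
length-concatMap f (x ∷ xs) = trans (length-++ (f x)) (cong (length (f x) +_) (length-concatMap f xs))

count : ∀ {A : Set} {P : Pred A 0ℓ} → Decidable P → List A → ℕ
count P? xs = length (filter P? xs)

module _ {A : Set} {P : Pred A 0ℓ} (P? : Decidable P) where

  count-++ : ∀ xs ys → count P? (xs ++ ys) ≡ count P? xs + count P? ys
  count-++ [] ys = refl
  count-++ (x ∷ xs) ys with does (P? x)
  ... | true = cong suc (count-++ xs ys)
  ... | false = count-++ xs ys

  count-concatMap : ∀ {B : Set} (f : B → List A) xs →
                    count P? (concatMap f xs) ≡ sumOver (λ x → count P? (f x)) xs
  count-concatMap f [] = refl
  count-concatMap f (x ∷ xs) = trans (count-++ (f x) _) (cong (count P? (f x) +_) (count-concatMap f xs))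

  count-map : ∀ {B : Set} (h : B → A) xs → count P? (map h xs) ≡ count (λ x → P? (h x)) xs
  count-map h [] = refl
  count-map h (x ∷ xs) with does (P? (h x))
  ... | true = cong suc (count-map h xs)
  ... | false = count-map h xs

  count-none : ∀ xs → (∀ x → x ∈ xs → ¬ P x) → count P? xs ≡ 0
  count-none [] _ = refl
  count-none (x ∷ xs) none with P? x
  ... | yes p = ⊥-elim (none x (here refl) p)
  ... | no _ = count-none xs (λ y y∈ → none y (there y∈))

  count-mono : ∀ {Q : Pred A 0ℓ} (Q? : Decidable Q) xs → (∀ x → P x → Q x) → count P? xs ≤ count Q? xs
  count-mono Q? [] _ = z≤n
  count-mono Q? (x ∷ xs) P⇒Q with P? x | Q? x
  ... | yes p | yes _ = s≤s (count-mono Q? xs P⇒Q)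
  ... | yes p | no ¬q = ⊥-elim (¬q (P⇒Q x p))
  ... | no _ | yes _ = m≤n⇒m≤1+n (count-mono Q? xs P⇒Q)
  ... | no _ | no _ = count-mono Q? xs P⇒Q

  count-disjoint-union : ∀ {Q R : Pred A 0ℓ} (Q? : Decidable Q) (R? : Decidable R) xs →
    (∀ x → P x → Q x ⊎ R x) → (∀ x → Q x → P x) → (∀ x → R x → P x) → (∀ x → Q x → R x → ⊥) →
    count P? xs ≡ count Q? xs + count R? xs
  count-disjoint-union Q? R? [] _ _ _ _ = refl
  count-disjoint-union Q? R? (x ∷ xs) split Q⇒P R⇒P disj
    with P? x | Q? x | R? x | count-disjoint-union Q? R? xs split Q⇒P R⇒P disj
  ... | _ | yes q | yes r | _ = ⊥-elim (disj x q r)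
  ... | yes _ | yes _ | no _ | ih = cong suc ih
  ... | yes _ | no _ | yes _ | ih = trans (cong suc ih) (sym (+-suc _ _))
  ... | yes p | no ¬q | no ¬r | _ = ⊥-elim ([ ¬q , ¬r ]′ (split x p))
  ... | no ¬p | yes q | _ | _ = ⊥-elim (¬p (Q⇒P x q))
  ... | no ¬p | no _ | yes r | _ = ⊥-elim (¬p (R⇒P x r))
  ... | no _ | no _ | no _ | ih = ih

  count-cong : ∀ {Q : Pred A 0ℓ} (Q? : Decidable Q) xs → (∀ x → P x ⇔ Q x) → count P? xs ≡ count Q? xs
  count-cong Q? [] _ = refl
  count-cong Q? (x ∷ xs) P⇔Q with P? x | Q? x
  ... | yes _ | yes _ = cong suc (count-cong Q? xs P⇔Q)
  ... | yes p | no ¬q = ⊥-elim (¬q (Equivalence.to (P⇔Q x) p))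
  ... | no ¬p | yes q = ⊥-elim (¬p (Equivalence.from (P⇔Q x) q))
  ... | no _ | no _ = count-cong Q? xs P⇔Q

  sumOver-two-values : ∀ {Q : Pred A 0ℓ} (Q? : Decidable Q) (w : A → ℕ) a b xs →
    (∀ x → x ∈ xs → P x → w x ≡ a) → (∀ x → x ∈ xs → Q x → w x ≡ b) →
    (∀ x → x ∈ xs → ¬ P x → ¬ Q x → w x ≡ 0) → (∀ x → P x → Q x → ⊥) →
    sumOver w xs ≡ a * count P? xs + b * count Q? xs
  sumOver-two-values Q? w a b [] _ _ _ _ = sym (cong₂ _+_ (*-zeroʳ a) (*-zeroʳ b))
  sumOver-two-values Q? w a b (x ∷ xs) onP onQ elsewhere disj
    with P? x | Q? x | sumOver-two-values Q? w a b xs (λ y y∈ → onP y (there y∈))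
                         (λ y y∈ → onQ y (there y∈)) (λ y y∈ → elsewhere y (there y∈)) disj
  ... | yes p | yes q | _ = ⊥-elim (disj x p q)
  ... | yes p | no _ | ih = begin
    w x + sumOver w xs                                ≡⟨ cong₂ _+_ (onP x (here refl) p) ih ⟩
    a + (a * count P? xs + b * count Q? xs)           ≡⟨ +-assoc a _ _ ⟨
    a + a * count P? xs + b * count Q? xs             ≡⟨ cong (_+ b * count Q? xs) (*-suc a _) ⟨
    a * suc (count P? xs) + b * count Q? xs           ∎
    where open ≡-Reasoning
  ... | no _ | yes q | ih = begin
    w x + sumOver w xs                                ≡⟨ cong₂ _+_ (onQ x (here refl) q) ih ⟩
    b + (a * count P? xs + b * count Q? xs)           ≡⟨ x∙yz≈y∙xz b (a * count P? xs) (b * count Q? xs) ⟩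
    a * count P? xs + (b + b * count Q? xs)           ≡⟨ cong (a * count P? xs +_) (*-suc b _) ⟨
    a * count P? xs + b * suc (count Q? xs)           ∎
    where open ≡-Reasoning
  ... | no ¬p | no ¬q | ih = trans (cong₂ _+_ (elsewhere x (here refl) ¬p ¬q) refl) ih

  count-singleton-yes : ∀ {x} → P x → count P? (x ∷ []) ≡ 1
  count-singleton-yes {x} p with P? x
  ... | yes _ = refl
  ... | no ¬p = ⊥-elim (¬p p)

  count-singleton-no : ∀ {x} → ¬ P x → count P? (x ∷ []) ≡ 0
  count-singleton-no {x} ¬p with P? x
  ... | yes p = ⊥-elim (¬p p)
  ... | no _ = refl

  count-filter : ∀ {Q : Pred A 0ℓ} (Q? : Decidable Q) xs →
                 count P? (filter Q? xs) ≡ count (λ x → P? x ×-dec Q? x) xs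
  count-filter Q? [] = refl
  count-filter Q? (x ∷ xs) with Q? x
  ... | no ¬q with P? x
  ...   | yes _ = count-filter Q? xs
  ...   | no _ = count-filter Q? xs
  count-filter Q? (x ∷ xs) | yes _ with P? x
  ...   | yes _ = cong suc (count-filter Q? xs)
  ...   | no _ = count-filter Q? xs

  count-all : ∀ xs → (∀ x → x ∈ xs → P x) → count P? xs ≡ length xs
  count-all xs all = cong length (filter-all P? (All.tabulate λ {x} x∈ → all x x∈))

module Colours (k : ℕ) where

  open import Data.List.Membership.DecPropositional (_≟ᶠ_ {k}) using (_∈?_; _∉?_)

  missing : List (Fin k) → ℕ
  missing ys = count (_∉? ys) (allFin k)

  missing-∷-∈ : ∀ {x ys} → x ∈ ys → missing (x ∷ ys) ≡ missing ys
  missing-∷-∈ {x} {ys} x∈ys = count-cong (_∉? (x ∷ ys)) (_∉? ys) (allFin k) λ z →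
    mk⇔ (λ z∉ z∈ → z∉ (there z∈)) λ { z∉ (here refl) → z∉ x∈ys ; z∉ (there z∈) → z∉ z∈ }

  count-≡ : ∀ x → count (_≟ᶠ x) (allFin k) ≡ 1
  count-≡ x = length-unique (filter⁺ (_≟ᶠ x) (allFin⁺ k)) ([] ∷ []) λ {z} →
    mk⇔ (λ z∈ → here (proj₂ (∈-filter⁻ (_≟ᶠ x) {xs = allFin k} z∈)))
        (λ { (here refl) → ∈-filter⁺ (_≟ᶠ x) (∈-allFin x) refl })

  missing-∷-∉ : ∀ {x ys} → x ∉ ys → missing ys ≡ suc (missing (x ∷ ys))
  missing-∷-∉ {x} {ys} x∉ys =
    trans (count-disjoint-union (_∉? ys) (_∉? (x ∷ ys)) (_≟ᶠ x) (allFin k) split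
             (λ z z∉ z∈ → z∉ (there z∈)) (λ { z refl → x∉ys })
             (λ { z z∉ refl → z∉ (here refl) }))
          (trans (cong (missing (x ∷ ys) +_) (count-≡ x)) (+-comm _ 1))
    where
    split : ∀ z → z ∉ ys → (z ∉ x ∷ ys) ⊎ (z ≡ x)
    split z z∉ with z ≟ᶠ x
    ... | yes z≡x = inj₂ z≡x
    ... | no z≢x = inj₁ λ { (here z≡x) → z≢x z≡x ; (there z∈) → z∉ z∈ }

  missing-antitone : ∀ {ws ys} → (∀ {x} → x ∈ ws → x ∈ ys) → missing ys ≤ missing ws
  missing-antitone {ws} {ys} ws⊆ys =
    count-mono (_∉? ys) (_∉? ws) (allFin k) (λ x x∉ys x∈ws → x∉ys (ws⊆ys x∈ws))

  missing-∷-≤ : ∀ x ys → missing (x ∷ ys) ≤ missing ys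
  missing-∷-≤ x ys = missing-antitone there

  missing-≤-suc : ∀ x ys → missing ys ≤ suc (missing (x ∷ ys))
  missing-≤-suc x ys with x ∈? ys
  ... | yes x∈ys = ≤-trans (≤-reflexive (sym (missing-∷-∈ x∈ys))) (n≤1+n _)
  ... | no x∉ys = ≤-reflexive (missing-∷-∉ x∉ys)

  missing-unique : ∀ {ws} → Unique ws → missing ws + length ws ≡ k
  missing-unique {ws} u = begin
    missing ws + length ws
      ≡⟨ length-++ (filter (_∉? ws) (allFin k)) ⟨
    length (filter (_∉? ws) (allFin k) ++ ws)
      ≡⟨ length-unique (++⁺ (filter⁺ (_∉? ws) (allFin⁺ k)) u disjoint) (allFin⁺ k) covers ⟩
    length (allFin k)
      ≡⟨ length-tabulate id ⟩
    k ∎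
    where
    open ≡-Reasoning
    disjoint : ∀ {x} → ¬ (x ∈ filter (_∉? ws) (allFin k) × x ∈ ws)
    disjoint (x∈ , x∈ws) = proj₂ (∈-filter⁻ (_∉? ws) {xs = allFin k} x∈) x∈ws
    covers : ∀ {x} → x ∈ filter (_∉? ws) (allFin k) ++ ws ⇔ x ∈ allFin k
    covers {x} = mk⇔ (λ _ → ∈-allFin x) λ _ → case (x ∈? ws)
      where
      case : Dec (x ∈ ws) → x ∈ filter (_∉? ws) (allFin k) ++ ws
      case (yes x∈ws) = ∈-++⁺ʳ _ x∈ws
      case (no x∉ws) = ∈-++⁺ˡ (∈-filter⁺ (_∉? ws) (∈-allFin x) x∉ws)

  missing-[] : missing [] ≡ k
  missing-[] = trans (sym (+-identityʳ _)) (missing-unique [])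

  missing≤0⇒all : ∀ ys → missing ys ≤ 0 → ∀ a → a ∈ ys
  missing≤0⇒all ys none a with a ∈? ys
  ... | yes a∈ys = a∈ys
  ... | no a∉ys = ⊥-elim (1+n≰n (≤-trans (nonempty (∈-filter⁺ (_∉? ys) (∈-allFin a) a∉ys)) none))
    where
    nonempty : ∀ {x : Fin k} {xs} → x ∈ xs → 1 ≤ length xs
    nonempty (here _) = s≤s z≤n
    nonempty (there _) = s≤s z≤n

  all⇒missing≡0 : ∀ ys → (∀ a → a ∈ ys) → missing ys ≡ 0
  all⇒missing≡0 ys all = count-none (_∉? ys) (allFin k) (λ a _ a∉ys → a∉ys (all a))

bump : ℕ → ℕ → ℕ
bump a c with a ≤? c
... | yes _ = suc c
... | no _ = c

bump-≤ : ∀ {a c} → a ≤ c → bump a c ≡ suc c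
bump-≤ {a} {c} a≤c with a ≤? c
... | yes _ = refl
... | no a≰c = contradiction a≤c a≰c

bump-> : ∀ {a c} → c < a → bump a c ≡ c
bump-> {a} {c} c<a with a ≤? c
... | yes a≤c = contradiction a≤c (<⇒≱ c<a)
... | no _ = refl

runCounter : ∀ {n} → ℕ → Vec ℕ n → ℕ
runCounter c [] = c
runCounter c (a ∷ b) = runCounter (bump a c) b

_<ᵛ_ : ∀ {n} → Vec ℕ n → Vec ℕ n → Set
b <ᵛ N = ∀ q → lookup b q < lookup N q

reaching : ∀ {n} (k : ℕ) → Vec ℕ n → ℕ → List (Vec ℕ n)
reaching k [] c with k ≤? c
... | yes _ = [] ∷ []
... | no _ = []
reaching k (N ∷ Ns) c = concatMap (λ a → map (a ∷_) (reaching k Ns (bump a c))) (downFrom N)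

module _ (k : ℕ) where

  ∈-reaching⁻ : ∀ {n} (Ns : Vec ℕ n) c {b} → b ∈ reaching k Ns c → b <ᵛ Ns × k ≤ runCounter c b
  ∈-reaching⁻ [] c {[]} b∈ with k ≤? c
  ... | yes k≤c = (λ ()) , k≤c
  ∈-reaching⁻ (N ∷ Ns) c b∈ with ∈-concatMap-elim _ {xs = downFrom N} b∈
  ... | a , a∈ , b∈' with ∈-map⁻ _ b∈'
  ... | b , b∈Ns , refl with ∈-reaching⁻ Ns (bump a c) b∈Ns
  ... | b<Ns , reached = (λ { fzero → ∈-downFrom⁻ a∈ ; (fsuc q) → b<Ns q }) , reached

  ∈-reaching⁺ : ∀ {n} (Ns : Vec ℕ n) c {b} → b <ᵛ Ns → k ≤ runCounter c b → b ∈ reaching k Ns c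
  ∈-reaching⁺ [] c {[]} _ k≤c with k ≤? c
  ... | yes _ = here refl
  ... | no k≰c = contradiction k≤c k≰c
  ∈-reaching⁺ (N ∷ Ns) c {a ∷ b} b<Ns reached =
    ∈-concatMap-intro _ (∈-downFrom⁺ (b<Ns fzero))
      (∈-map⁺ _ (∈-reaching⁺ Ns (bump a c) (λ q → b<Ns (fsuc q)) reached))

  unique-reaching : ∀ {n} (Ns : Vec ℕ n) c → Unique (reaching k Ns c)
  unique-reaching [] c with k ≤? c
  ... | yes _ = [] ∷ []
  ... | no _ = []
  unique-reaching (N ∷ Ns) c = unique-concatMap _ (downFrom⁺ N)
    (λ a → map⁺ (λ e → proj₂ (∷-injective e)) (unique-reaching Ns (bump a c)))
    (λ b∈ b∈' → let (_ , _ , e) = ∈-map⁻ _ b∈ ; (_ , _ , e') = ∈-map⁻ _ b∈'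
                in proj₁ (∷-injective (trans (sym e) e')))

  length-reaching : ∀ {n} N (Ns : Vec ℕ n) c →
    length (reaching k (N ∷ Ns) c) ≡ sumOver (λ a → length (reaching k Ns (bump a c))) (downFrom N)
  length-reaching N Ns c = trans (length-concatMap _ (downFrom N))
    (sumOver-cong (downFrom N) (λ a → length-map (a ∷_) (reaching k Ns (bump a c))))

sum-bump-≤ : ∀ (g : ℕ → ℕ) c N → N ≤ suc c →
  sumOver (λ a → g (bump a c)) (downFrom N) ≡ N * g (suc c)
sum-bump-≤ g c zero _ = refl
sum-bump-≤ g c (suc N) (s≤s N≤c) =
  cong₂ _+_ (cong g (bump-≤ N≤c)) (sum-bump-≤ g c N (m≤n⇒m≤1+n N≤c))

sum-bump-> : ∀ (g : ℕ → ℕ) c N → suc c ≤ N →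
  sumOver (λ a → g (bump a c)) (downFrom N) ≡ suc c * g (suc c) + (N ∸ suc c) * g c
sum-bump-> g c (suc N) (s≤s c≤N) with m≤n⇒m<n∨m≡n c≤N
... | inj₂ refl = begin
  g (bump c c) + sumOver (λ a → g (bump a c)) (downFrom c)
    ≡⟨ cong₂ _+_ (cong g (bump-≤ ≤-refl)) (sum-bump-≤ g c c (n≤1+n c)) ⟩
  suc c * g (suc c)
    ≡⟨ +-identityʳ _ ⟨
  suc c * g (suc c) + 0 * g c
    ≡⟨ cong (λ m → suc c * g (suc c) + m * g c) (n∸n≡0 c) ⟨
  suc c * g (suc c) + (c ∸ c) * g c ∎
  where open ≡-Reasoning
... | inj₁ c<N = begin
  g (bump N c) + sumOver (λ a → g (bump a c)) (downFrom N)
    ≡⟨ cong₂ _+_ (cong g (bump-> c<N)) (sum-bump-> g c N c<N) ⟩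
  g c + (suc c * g (suc c) + (N ∸ suc c) * g c)
    ≡⟨ x∙yz≈y∙xz (g c) (suc c * g (suc c)) _ ⟩
  suc c * g (suc c) + suc (N ∸ suc c) * g c
    ≡⟨ cong (λ m → suc c * g (suc c) + m * g c) (+-∸-assoc 1 c<N) ⟨
  suc c * g (suc c) + (N ∸ c) * g c ∎
  where open ≡-Reasoning

∈-take⇒∈ : ∀ {A : Set} {x : A} t xs → x ∈ take t xs → x ∈ xs
∈-take⇒∈ (suc t) (y ∷ xs) (here x≡y) = here x≡y
∈-take⇒∈ (suc t) (y ∷ xs) (there x∈) = there (∈-take⇒∈ t xs x∈)

∈-take-mono : ∀ {A : Set} {x : A} {t u} xs → t ≤ u → x ∈ take t xs → x ∈ take u xs
∈-take-mono {t = suc t} {suc u} (y ∷ xs) (s≤s t≤u) (here x≡y) = here x≡y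
∈-take-mono {t = suc t} {suc u} (y ∷ xs) (s≤s t≤u) (there x∈) = there (∈-take-mono xs t≤u x∈)

lookup∈toList : ∀ {A : Set} {n} (g : Vec A n) q → lookup g q ∈ toList g
lookup∈toList (x ∷ g) fzero = here refl
lookup∈toList (x ∷ g) (fsuc q) = there (lookup∈toList g q)

∈toList⇒lookup : ∀ {A : Set} {n} (g : Vec A n) {y} → y ∈ toList g → Σ (Fin n) λ q → lookup g q ≡ y
∈toList⇒lookup (x ∷ g) (here y≡x) = fzero , sym y≡x
∈toList⇒lookup (x ∷ g) (there y∈) = let (q , e) = ∈toList⇒lookup g y∈ in fsuc q , e

lookup∈take : ∀ {A : Set} {n} (g : Vec A n) q t → toℕ q < t → lookup g q ∈ take t (toList g)
lookup∈take (x ∷ g) fzero (suc t) _ = here refl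
lookup∈take (x ∷ g) (fsuc q) (suc t) (s≤s q<t) = there (lookup∈take g q t q<t)

∈take⇒lookup : ∀ {A : Set} {n} (g : Vec A n) t {y} → y ∈ take t (toList g) →
               Σ (Fin n) λ q → toℕ q < t × y ≡ lookup g q
∈take⇒lookup (x ∷ g) (suc t) (here y≡x) = fzero , s≤s z≤n , y≡x
∈take⇒lookup (x ∷ g) (suc t) (there y∈) =
  let (q , q<t , y≡) = ∈take⇒lookup g t y∈ in fsuc q , s≤s q<t , y≡

module Windowed (k : ℕ) where

  open Colours k
  open import Data.List.Membership.DecPropositional (_≟ᶠ_ {k}) using (_∉?_)

  window : ∀ {n} → ℕ → Vec (Fin k) n → List (Fin k)
  window w g = take w (toList g)

  Respects : ∀ {n} → Vec ℕ n → Vec (Fin k) n → Set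
  Respects [] [] = ⊤
  Respects (w ∷ s) (x ∷ g) = x ∉ window w g × Respects s g

  available : ∀ {n} → ℕ → Vec (Fin k) n → List (Fin k)
  available w g = filter (_∉? window w g) (allFin k)

  extensions : ∀ {n} → ℕ → Vec (Fin k) n → List (Vec (Fin k) (suc n))
  extensions w g = map (_∷ g) (available w g)

  colourings : ∀ {n} → Vec ℕ n → List (Vec (Fin k) n)
  colourings [] = [] ∷ []
  colourings (w ∷ s) = concatMap (extensions w) (colourings s)

  ∈-colourings⁻ : ∀ {n} (s : Vec ℕ n) {g} → g ∈ colourings s → Respects s g
  ∈-colourings⁻ [] {[]} (here refl) = tt
  ∈-colourings⁻ (w ∷ s) g∈ with ∈-concatMap-elim (extensions w) {xs = colourings s} g∈
  ... | g , g∈s , ext∈ with ∈-map⁻ _ ext∈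
  ... | x , x∈ , refl = proj₂ (∈-filter⁻ (_∉? window w g) {xs = allFin k} x∈) , ∈-colourings⁻ s g∈s

  ∈-colourings⁺ : ∀ {n} (s : Vec ℕ n) {g} → Respects s g → g ∈ colourings s
  ∈-colourings⁺ [] {[]} tt = here refl
  ∈-colourings⁺ (w ∷ s) {x ∷ g} (x∉ , respects) = ∈-concatMap-intro (extensions w)
    (∈-colourings⁺ s respects) (∈-map⁺ _ (∈-filter⁺ (_∉? window w g) (∈-allFin x) x∉))

  unique-colourings : ∀ {n} (s : Vec ℕ n) → Unique (colourings s)
  unique-colourings [] = [] ∷ []
  unique-colourings (w ∷ s) = unique-concatMap (extensions w) (unique-colourings s)
    (λ g → map⁺ (λ e → proj₁ (∷-injective e)) (filter⁺ _ (allFin⁺ k)))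
    (λ g∈ g∈' → let (_ , _ , e) = ∈-map⁻ _ g∈ ; (_ , _ , e') = ∈-map⁻ _ g∈'
                in proj₂ (∷-injective (trans (sym e) e')))

  head₀ : ∀ {n} → Vec ℕ n → ℕ
  head₀ [] = 0
  head₀ (w ∷ _) = w

  Admissible : ∀ {n} → Vec ℕ n → Set
  Admissible [] = ⊤
  Admissible {suc n} (w ∷ s) = w ≤ n × w < k × w ≤ suc (head₀ s) × Admissible s

  prefix-unique : ∀ {n} (s : Vec ℕ n) g → Admissible s → Respects s g →
                  ∀ t → t ≤ suc (head₀ s) → Unique (take t (toList g))
  prefix-unique _ _ _ _ zero _ = []
  prefix-unique [] [] _ _ (suc t) _ = []
  prefix-unique (w ∷ s) (y ∷ g) (_ , _ , w≤ , admissible) (y∉ , respects) (suc t) (s≤s t≤w) =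
    All.tabulate (λ z∈ y≡z → y∉ (∈-take-mono (toList g) t≤w (subst (_∈ _) (sym y≡z) z∈)))
    ∷ prefix-unique s g admissible respects t (≤-trans t≤w w≤)

  missing-window : ∀ {n} w (s : Vec ℕ n) g → Admissible (w ∷ s) → Respects s g →
                   missing (window w g) ≡ k ∸ w
  missing-window w s g (w≤n , _ , w≤ , admissible) respects = begin
    missing (window w g)
      ≡⟨ m+n∸n≡m _ w ⟨
    missing (window w g) + w ∸ w
      ≡⟨ cong (λ l → missing (window w g) + l ∸ w) length-window ⟨
    missing (window w g) + length (window w g) ∸ w
      ≡⟨ cong (_∸ w) (missing-unique (prefix-unique s g admissible respects w w≤)) ⟩
    k ∸ w ∎
    where
    open ≡-Reasoning
    length-window : length (window w g) ≡ w
    length-window = trans (length-take w (toList g))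
                          (trans (cong (w ⊓_) (length-toList g)) (m≤n⇒m⊓n≡m w≤n))

  missesAtMost : ∀ {n} c → Decidable (λ (g : Vec (Fin k) n) → missing (toList g) ≤ c)
  missesAtMost c g = missing (toList g) ≤? c

  missesExactly : ∀ {n} m → Decidable (λ (g : Vec (Fin k) n) → missing (toList g) ≡ m)
  missesExactly m g = missing (toList g) ≟ m

  #missing≤ : ∀ {n} → Vec ℕ n → ℕ → ℕ
  #missing≤ s c = count (missesAtMost c) (colourings s)

  #missing≡ : ∀ {n} → Vec ℕ n → ℕ → ℕ
  #missing≡ s m = count (missesExactly m) (colourings s)

  #missing≤-suc : ∀ {n} (s : Vec ℕ n) c → #missing≤ s (suc c) ≡ #missing≤ s c + #missing≡ s (suc c)
  #missing≤-suc s c =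
    count-disjoint-union (missesAtMost (suc c)) (missesAtMost c) (missesExactly (suc c)) (colourings s)
    (λ _ m≤ → Sum.map (λ { (s≤s m≤c) → m≤c }) id (m≤n⇒m<n∨m≡n m≤))
    (λ _ → m≤n⇒m≤1+n) (λ _ → ≤-reflexive) (λ _ m≤c m≡ → 1+n≰n (subst (_≤ c) m≡ m≤c))

  goodExtensions : ∀ {n} → ℕ → ℕ → Vec (Fin k) n → ℕ
  goodExtensions w c g = count (λ x → missesAtMost c (x ∷ g)) (available w g)

  goodExtensions-≤ : ∀ {n} w c (s : Vec ℕ n) g → Admissible (w ∷ s) → Respects s g →
                     missing (toList g) ≤ c → goodExtensions w c g ≡ k ∸ w
  goodExtensions-≤ w c s g adm respects m≤c =
    trans (count-all (λ x → missesAtMost c (x ∷ g)) (available w g)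
                     (λ x _ → ≤-trans (missing-∷-≤ x (toList g)) m≤c))
          (missing-window w s g adm respects)

  goodExtensions-≡ : ∀ {n} w c (g : Vec (Fin k) n) → missing (toList g) ≡ suc c →
                     goodExtensions w c g ≡ suc c
  goodExtensions-≡ w c g m≡ =
    trans (count-filter (λ x → missesAtMost c (x ∷ g)) (_∉? window w g) (allFin k))
          (trans (count-cong (λ x → missesAtMost c (x ∷ g) ×-dec x ∉? window w g) (_∉? toList g) (allFin k)
                               λ x → mk⇔ (to x) (from x))
                 m≡)
    where
    to : ∀ x → missing (x ∷ toList g) ≤ c × x ∉ window w g → x ∉ toList g
    to x (m≤c , _) x∈g = 1+n≰n (subst (_≤ c) (trans (missing-∷-∈ x∈g) m≡) m≤c)
    from : ∀ x → x ∉ toList g → missing (x ∷ toList g) ≤ c × x ∉ window w g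
    from x x∉g = ≤-pred (subst (_≤ suc c) (missing-∷-∉ x∉g) (≤-reflexive m≡)) ,
                 λ x∈ → x∉g (∈-take⇒∈ w (toList g) x∈)

  goodExtensions-> : ∀ {n} w c (g : Vec (Fin k) n) → suc c < missing (toList g) →
                     goodExtensions w c g ≡ 0
  goodExtensions-> w c g c<m = count-none (λ x → missesAtMost c (x ∷ g)) (available w g) λ x _ m≤c →
    <⇒≱ c<m (≤-trans (missing-≤-suc x (toList g)) (s≤s m≤c))

  #missing≤-rec : ∀ {n} w (s : Vec ℕ n) c → Admissible (w ∷ s) →
    #missing≤ (w ∷ s) c ≡ (k ∸ w) * #missing≤ s c + suc c * #missing≡ s (suc c)
  #missing≤-rec w s c adm = begin
    #missing≤ (w ∷ s) c
      ≡⟨ count-concatMap (missesAtMost c) (extensions w) (colourings s) ⟩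
    sumOver (λ g → count (missesAtMost c) (extensions w g)) (colourings s)
      ≡⟨ sumOver-cong (colourings s) (λ g → count-map (missesAtMost c) (_∷ g) (available w g)) ⟩
    sumOver (goodExtensions w c) (colourings s)
      ≡⟨ sumOver-two-values (missesAtMost c) (missesExactly (suc c)) (goodExtensions w c)
                            (k ∸ w) (suc c) (colourings s)
           (λ g g∈ → goodExtensions-≤ w c s g adm (∈-colourings⁻ s g∈))
           (λ g _ → goodExtensions-≡ w c g)
           (λ g _ m≰c m≢ → goodExtensions-> w c g (≤∧≢⇒< (≰⇒> m≰c) (m≢ ∘ sym)))
           (λ g m≤c m≡ → 1+n≰n (subst (_≤ c) m≡ m≤c)) ⟩
    (k ∸ w) * #missing≤ s c + suc c * #missing≡ s (suc c)
      ∎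
    where open ≡-Reasoning

  -- A colouring misses at most as many colours as its first window does.
  #missing≡-vanishes : ∀ {n} w (s : Vec ℕ n) c → Admissible (w ∷ s) → k ∸ w ≤ c →
                       #missing≡ s (suc c) ≡ 0
  #missing≡-vanishes w s c adm kw≤c = count-none (missesExactly (suc c)) (colourings s) λ g g∈ m≡ →
    1+n≰n (begin
      suc c                   ≡⟨ m≡ ⟨
      missing (toList g)      ≤⟨ missing-antitone (∈-take⇒∈ w (toList g)) ⟩
      missing (window w g)    ≡⟨ missing-window w s g adm (∈-colourings⁻ s g∈) ⟩
      k ∸ w                   ≤⟨ kw≤c ⟩
      c                       ∎)
    where open ≤-Reasoning

  -- One step of the counting identity: if it holds for the windows s, it holds
  -- for w ∷ s, by comparing the recursions for both sides in the first entry.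
  module CountingStep {n} (w : ℕ) (s : Vec ℕ n) (adm : Admissible (w ∷ s))
    (IH : ∀ c → length (reaching k (Vec.map (k ∸_) s) c) ≡ #missing≤ s c) (c : ℕ) where

    open ≡-Reasoning

    N = k ∸ w
    Ns = Vec.map (k ∸_) s
    F = #missing≤ s c
    D = #missing≡ s (suc c)

    r : ℕ → ℕ
    r c' = length (reaching k Ns c')

    r-suc : r (suc c) ≡ F + D
    r-suc = trans (IH (suc c)) (#missing≤-suc s c)

    -- When c < N, some first entries bump the counter and some do not.
    large : suc c ≤ N → length (reaching k (N ∷ Ns) c) ≡ #missing≤ (w ∷ s) c
    large c<N = begin
      length (reaching k (N ∷ Ns) c)               ≡⟨ length-reaching k N Ns c ⟩
      sumOver (λ a → r (bump a c)) (downFrom N)    ≡⟨ sum-bump-> r c N c<N ⟩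
      suc c * r (suc c) + (N ∸ suc c) * r c        ≡⟨ cong₂ (λ x y → suc c * x + (N ∸ suc c) * y) r-suc (IH c) ⟩
      suc c * (F + D) + (N ∸ suc c) * F            ≡⟨ regroup (suc c) (N ∸ suc c) F D ⟩
      (suc c + (N ∸ suc c)) * F + suc c * D        ≡⟨ cong (λ x → x * F + suc c * D) (m+[n∸m]≡n c<N) ⟩
      N * F + suc c * D                            ≡⟨ #missing≤-rec w s c adm ⟨
      #missing≤ (w ∷ s) c                          ∎
      where
      regroup : ∀ m M F D → m * (F + D) + M * F ≡ (m + M) * F + m * D
      regroup = solve-∀

    -- When N ≤ c, every first entry bumps the counter, and no colouring
    -- misses c + 1 colours.
    small : N ≤ c → length (reaching k (N ∷ Ns) c) ≡ #missing≤ (w ∷ s) c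
    small N≤c = begin
      length (reaching k (N ∷ Ns) c)               ≡⟨ length-reaching k N Ns c ⟩
      sumOver (λ a → r (bump a c)) (downFrom N)    ≡⟨ sum-bump-≤ r c N (≤-trans N≤c (n≤1+n c)) ⟩
      N * r (suc c)                                ≡⟨ cong (N *_) r-suc ⟩
      N * (F + D)                                  ≡⟨ cong (λ d → N * (F + d)) D≡0 ⟩
      N * (F + 0)                                  ≡⟨ drop-zero N F (suc c) ⟩
      N * F + suc c * 0                            ≡⟨ cong (λ d → N * F + suc c * d) D≡0 ⟨
      N * F + suc c * D                            ≡⟨ #missing≤-rec w s c adm ⟨
      #missing≤ (w ∷ s) c                          ∎
      where
      D≡0 : D ≡ 0
      D≡0 = #missing≡-vanishes w s c adm N≤c
      drop-zero : ∀ N F m → N * (F + 0) ≡ N * F + m * 0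
      drop-zero = solve-∀

  reaching≡colourings : ∀ {n} (s : Vec ℕ n) → Admissible s → ∀ c →
                        length (reaching k (Vec.map (k ∸_) s) c) ≡ #missing≤ s c
  reaching≡colourings [] _ c with k ≤? c
  ... | yes k≤c = sym (count-singleton-yes (missesAtMost c) (subst (_≤ c) (sym missing-[]) k≤c))
  ... | no k≰c = sym (count-singleton-no (missesAtMost c) (λ m≤c → k≰c (subst (_≤ c) missing-[] m≤c)))
  reaching≡colourings (w ∷ s) adm@(_ , _ , _ , admissible) c with suc c ≤? k ∸ w
  ... | yes c<N = CountingStep.large w s adm (reaching≡colourings s admissible) c c<N
  ... | no c≮N = CountingStep.small w s adm (reaching≡colourings s admissible) c (≤-pred (≰⇒> c≮N))

  admissible-tabulate : ∀ {n} (f : Fin n → ℕ) → (∀ q → f q ≤ toℕ (opposite q)) → (∀ q → f q < k) →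
    (∀ q q' → toℕ q' ≡ suc (toℕ q) → f q ≤ suc (f q')) → Admissible (tabulate f)
  admissible-tabulate {zero} f _ _ _ = tt
  admissible-tabulate {suc n} f fits small grows =
    f₀≤n , small fzero , grows-head n f grows f₀≤n ,
    admissible-tabulate (f ∘ fsuc) (λ q → subst (f (fsuc q) ≤_) (opposite-suc q) (fits (fsuc q)))
      (small ∘ fsuc) (λ q q' e → grows (fsuc q) (fsuc q') (cong suc e))
    where
    f₀≤n : f fzero ≤ n
    f₀≤n = subst (f fzero ≤_) (toℕ-fromℕ n) (fits fzero)
    grows-head : ∀ m (f : Fin (suc m) → ℕ) → (∀ q q' → toℕ q' ≡ suc (toℕ q) → f q ≤ suc (f q')) →
                 f fzero ≤ m → f fzero ≤ suc (head₀ (tabulate (f ∘ fsuc)))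
    grows-head zero f _ f₀≤0 = m≤n⇒m≤1+n f₀≤0
    grows-head (suc m) f grows _ = grows fzero (fsuc fzero) refl

  Respects⇔distinct : ∀ {n} (s : Vec ℕ n) g → Respects s g ⇔
    (∀ q q' → toℕ q < toℕ q' → toℕ q' ≤ toℕ q + lookup s q → lookup g q ≢ lookup g q')
  Respects⇔distinct s g = mk⇔ (to s g) (from s g)
    where
    to : ∀ {n} (s : Vec ℕ n) g → Respects s g →
         ∀ q q' → toℕ q < toℕ q' → toℕ q' ≤ toℕ q + lookup s q → lookup g q ≢ lookup g q'
    to (w ∷ s) (x ∷ g) (x∉ , _) fzero (fsuc q') _ q'<w x≡ =
      x∉ (subst (_∈ _) (sym x≡) (lookup∈take g q' w q'<w))
    to (w ∷ s) (x ∷ g) (_ , respects) (fsuc q) (fsuc q') (s≤s q<q') (s≤s q'≤) = to s g respects q q' q<q' q'≤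
    from : ∀ {n} (s : Vec ℕ n) g →
           (∀ q q' → toℕ q < toℕ q' → toℕ q' ≤ toℕ q + lookup s q → lookup g q ≢ lookup g q') → Respects s g
    from [] [] _ = tt
    from (w ∷ s) (x ∷ g) distinct =
      (λ x∈ → let (q , q<w , x≡) = ∈take⇒lookup g w x∈ in distinct fzero (fsuc q) (s≤s z≤n) q<w x≡) ,
      from s g (λ q q' q<q' q'≤ → distinct (fsuc q) (fsuc q') (s≤s q<q') (s≤s q'≤))

-- The reverse skip monomial is defined through opposite
-- positions, so we read exponent vectors from x_n down to x_1.
mirror : ∀ {A : Set} {n} → Vec A n → Vec A n
mirror v = tabulate (λ q → lookup v (opposite q))

lookup-mirror : ∀ {A : Set} {n} (v : Vec A n) q → lookup (mirror v) q ≡ lookup v (opposite q)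
lookup-mirror v q = lookup∘tabulate (λ q → lookup v (opposite q)) q

lookup-mirror-opposite : ∀ {A : Set} {n} (v : Vec A n) q → lookup (mirror v) (opposite q) ≡ lookup v q
lookup-mirror-opposite v q = trans (lookup-mirror v (opposite q)) (cong (lookup v) (opposite-involutive q))

mirror-involutive : ∀ {A : Set} {n} (v : Vec A n) → mirror (mirror v) ≡ v
mirror-involutive v = trans (tabulate-cong (lookup-mirror-opposite v)) (tabulate∘lookup v)

mirror-injective : ∀ {A : Set} {n} {v w : Vec A n} → mirror v ≡ mirror w → v ≡ w
mirror-injective {v = v} {w} e = trans (sym (mirror-involutive v)) (trans (cong mirror e) (mirror-involutive w))

<ᵇ-suc : ∀ a b → (a <ᵇ suc b) ≡ (a ≤ᵇ b)
<ᵇ-suc zero b = refl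
<ᵇ-suc (suc a) zero with a
... | zero = refl
... | suc _ = refl
<ᵇ-suc (suc a) (suc b) = refl

shifted-window : ∀ {n} (q : Fin n) →
  tabulate (λ q' → ⌊ fsuc q' ≤ᶠ? fsuc q ⌋) ≡ tabulate (λ q' → ⌊ q' ≤ᶠ? q ⌋)
shifted-window {n} q = tabulate-cong {n = n} λ q' →
  trans (isYes≗does (fsuc q' ≤ᶠ? fsuc q)) (trans (<ᵇ-suc (toℕ q') (toℕ q)) (sym (isYes≗does (q' ≤ᶠ? q))))

indicator : Bool → ℕ
indicator b = if b then 1 else 0

∣∩empty∣ : ∀ {n} (S : Subset n) → ∣ S ∩ tabulate (λ _ → false) ∣ ≡ 0
∣∩empty∣ [] = refl
∣∩empty∣ (true ∷ S) = ∣∩empty∣ S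
∣∩empty∣ (false ∷ S) = ∣∩empty∣ S

rank-zero : ∀ {n} s (S : Subset n) → rank (s ∷ S) fzero ≡ indicator s
rank-zero true S = cong suc (∣∩empty∣ S)
rank-zero false S = ∣∩empty∣ S

rank-suc : ∀ {n} s (S : Subset n) q → rank (s ∷ S) (fsuc q) ≡ indicator s + rank S q
rank-suc true S q = cong (λ t → suc ∣ S ∩ t ∣) (shifted-window q)
rank-suc false S q = cong (λ t → ∣ S ∩ t ∣) (shifted-window q)

rank≤ : ∀ {n} (S : Subset n) q → rank S q ≤ suc (toℕ q)
rank≤ (true ∷ S) fzero = ≤-reflexive (rank-zero true S)
rank≤ (false ∷ S) fzero = ≤-trans (≤-reflexive (rank-zero false S)) z≤n
rank≤ (true ∷ S) (fsuc q) = ≤-trans (≤-reflexive (rank-suc true S q)) (s≤s (rank≤ S q))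
rank≤ (false ∷ S) (fsuc q) = ≤-trans (≤-reflexive (rank-suc false S q)) (m≤n⇒m≤1+n (rank≤ S q))

gaps : ∀ {n} → Subset n → Fin n → ℕ
gaps S q = suc (toℕ q) ∸ rank S q

gaps-head : ∀ {n} (S : Subset n) → gaps (true ∷ S) fzero ≡ 0
gaps-head S = cong (1 ∸_) (rank-zero true S)

gaps-in : ∀ {n} (S : Subset n) q → gaps (true ∷ S) (fsuc q) ≡ gaps S q
gaps-in S q = cong (suc (suc (toℕ q)) ∸_) (rank-suc true S q)

gaps-out : ∀ {n} (S : Subset n) q → gaps (false ∷ S) (fsuc q) ≡ suc (gaps S q)
gaps-out S q = trans (cong (suc (suc (toℕ q)) ∸_) (rank-suc false S q)) (+-∸-assoc 1 (rank≤ S q))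

Fits : ∀ {n} → ℕ → Subset n → Vec ℕ n → Set
Fits c S b = ∀ q → lookup S q ≡ true → c + gaps S q < lookup b q

skips : ∀ {n} → ℕ → Vec ℕ n → ℕ
skips c [] = 0
skips c (x ∷ b) with x ≤? c
... | yes _ = skips (suc c) b
... | no _ = suc (skips c b)

skips+runCounter : ∀ {n} c (b : Vec ℕ n) → skips c b + runCounter c b ≡ c + n
skips+runCounter c [] = sym (+-identityʳ c)
skips+runCounter {suc n} c (x ∷ b) with x ≤? c
... | yes _ = trans (skips+runCounter (suc c) b) (sym (+-suc c n))
... | no _ = trans (cong suc (skips+runCounter c b)) (sym (+-suc c n))

fits-in⁺ : ∀ {n} {c x} {S : Subset n} {b} → c < x → Fits c S b → Fits c (true ∷ S) (x ∷ b)
fits-in⁺ {c = c} {S = S} c<x _ fzero _ = subst (_< _) (sym (trans (cong (c +_) (gaps-head S)) (+-identityʳ c))) c<x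
fits-in⁺ {c = c} {S = S} {b} _ fits (fsuc q) q∈S =
  subst (λ g → c + g < lookup b q) (sym (gaps-in S q)) (fits q q∈S)

fits-in⁻ : ∀ {n} {c x} {S : Subset n} {b} → Fits c (true ∷ S) (x ∷ b) → c < x × Fits c S b
fits-in⁻ {c = c} {S = S} {b} fits =
  subst (_< _) (trans (cong (c +_) (gaps-head S)) (+-identityʳ c)) (fits fzero refl) ,
  λ q q∈S → subst (λ g → c + g < lookup b q) (gaps-in S q) (fits (fsuc q) q∈S)

fits-out : ∀ {n} {c x} {S : Subset n} {b} → Fits c (false ∷ S) (x ∷ b) ⇔ Fits (suc c) S b
fits-out {c = c} {S = S} {b} = mk⇔
  (λ fits q q∈S → subst (_< lookup b q) (shift q) (fits (fsuc q) q∈S))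
  (λ { fits (fsuc q) q∈S → subst (_< lookup b q) (sym (shift q)) (fits q q∈S) })
  where
  shift : ∀ q → c + gaps (false ∷ S) (fsuc q) ≡ suc c + gaps S q
  shift q = trans (cong (c +_) (gaps-out S q)) (+-suc c (gaps S q))

fits-lower : ∀ {n} {c} {S : Subset n} {b} → Fits (suc c) S b → Fits c S b
fits-lower {c = c} {S} fits q q∈S = <-trans (+-monoˡ-< (gaps S q) (n<1+n c)) (fits q q∈S)

-- Placing skipped entries into S greedily, any number t ≤ skips of them fits.
greedy-fits : ∀ {n} c (b : Vec ℕ n) t → t ≤ skips c b → Σ (Subset n) λ S → ∣ S ∣ ≡ t × Fits c S b
greedy-fits c [] zero _ = [] , refl , λ ()
greedy-fits {suc n} c (x ∷ b) t t≤ with x ≤? c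
... | yes _ = let (S , ∣S∣ , fits) = greedy-fits (suc c) b t t≤
              in false ∷ S , ∣S∣ , Equivalence.from (fits-out {x = x}) fits
... | no x≰c with t
...   | zero = replicate (suc n) false , ∣⊥∣≡0 (suc n) ,
               λ q q∈ → contradiction (trans (sym (lookup-replicate q false)) q∈) λ ()
...   | suc t' = let (S , ∣S∣ , fits) = greedy-fits c b t' (≤-pred t≤)
                 in true ∷ S , cong suc ∣S∣ , fits-in⁺ (≰⇒> x≰c) fits

fits⇒≤skips : ∀ {n} c (b : Vec ℕ n) S → Fits c S b → ∣ S ∣ ≤ skips c b
fits⇒≤skips c [] [] _ = z≤n
fits⇒≤skips c (x ∷ b) (true ∷ S) fits with fits-in⁻ {S = S} fits | x ≤? c
... | c<x , _ | yes x≤c = contradiction x≤c (<⇒≱ c<x)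
... | _ , fits-tail | no _ = s≤s (fits⇒≤skips c b S fits-tail)
fits⇒≤skips c (x ∷ b) (false ∷ S) fits with x ≤? c
... | yes _ = fits⇒≤skips (suc c) b S (Equivalence.to (fits-out {x = x}) fits)
... | no _ = m≤n⇒m≤1+n (fits⇒≤skips c b S (fits-lower {c = c} {S} {b} (Equivalence.to (fits-out {x = x}) fits)))

lookup-revSkipMonomial : ∀ {n} (S : Subset n) q →
  lookup (revSkipMonomial S) (opposite q) ≡ (if lookup S q then gaps S q + 1 else 0)
lookup-revSkipMonomial S q =
  trans (lookup∘tabulate _ (opposite q))
        (trans (cong (lookup (skipSeq S)) (opposite-involutive q)) (lookup∘tabulate _ q))

revSkip∣⇔fits : ∀ {n} (S : Subset n) (m : Monomial n) → revSkipMonomial S ∣ₘ m ⇔ Fits 0 S (mirror m)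
revSkip∣⇔fits S m = mk⇔ to from
  where
  to : revSkipMonomial S ∣ₘ m → Fits 0 S (mirror m)
  to divides q q∈S = subst₂ _≤_
    (trans (lookup-revSkipMonomial S q) (trans (cong (λ s → if s then gaps S q + 1 else 0) q∈S) (+-comm (gaps S q) 1)))
    (sym (lookup-mirror m q)) (divides (opposite q))
  bound : Fits 0 S (mirror m) → ∀ q s → lookup S q ≡ s → (if s then gaps S q + 1 else 0) ≤ lookup m (opposite q)
  bound fits q false _ = z≤n
  bound fits q true q∈S = subst₂ _≤_ (+-comm 1 (gaps S q)) (lookup-mirror m q) (fits q q∈S)
  from : Fits 0 S (mirror m) → revSkipMonomial S ∣ₘ m
  from fits p = subst (λ p' → lookup (revSkipMonomial S) p' ≤ lookup m p') (opposite-involutive p)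
    (subst (_≤ lookup m (opposite (opposite p))) (sym (lookup-revSkipMonomial S (opposite p)))
      (bound fits (opposite p) _ refl))

NoSkip : ∀ n → ℕ → Monomial n → Set
NoSkip n k m = ∀ (S : Subset n) → ∣ S ∣ ≡ n ∸ k + 1 → ¬ (revSkipMonomial S ∣ₘ m)

-- It says that the greedy counter on the mirror image of m reaches k: by the
-- greedy lemmas the largest fitting set has n minus the counter's final value
-- elements.
noSkip⇔reaches : ∀ {n} k (m : Monomial n) → k ≤ n → NoSkip n k m ⇔ k ≤ runCounter 0 (mirror m)
noSkip⇔reaches {n} k m k≤n = mk⇔ to from
  where
  run = runCounter 0 (mirror m)
  skips≡ : skips 0 (mirror m) ≡ n ∸ run
  skips≡ = trans (sym (m+n∸n≡m _ run)) (cong (_∸ run) (skips+runCounter 0 (mirror m)))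
  to : NoSkip n k m → k ≤ run
  to noSkip with k ≤? run
  ... | yes k≤run = k≤run
  ... | no k≰run =
    let (S , ∣S∣ , fits) = greedy-fits 0 (mirror m) (n ∸ k + 1)
                             (subst₂ _≤_ (+-comm 1 (n ∸ k)) (sym skips≡) (∸-monoʳ-< (≰⇒> k≰run) k≤n))
    in ⊥-elim (noSkip S ∣S∣ (Equivalence.from (revSkip∣⇔fits S m) fits))
  from : k ≤ run → NoSkip n k m
  from k≤run S ∣S∣ divides = 1+n≰n (begin
    suc (n ∸ k)           ≡⟨ +-comm 1 (n ∸ k) ⟩
    n ∸ k + 1             ≡⟨ ∣S∣ ⟨
    ∣ S ∣                 ≤⟨ fits⇒≤skips 0 (mirror m) S (Equivalence.to (revSkip∣⇔fits S m) divides) ⟩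
    skips 0 (mirror m)    ≡⟨ skips≡ ⟩
    n ∸ run               ≤⟨ ∸-monoʳ-≤ n k≤run ⟩
    n ∸ k                 ∎)
    where open ≤-Reasoning

-- The position (counted from 0) of letter p + 1 inside its batch.
batchPos : ∀ {r} → Vec ℕ r → ℕ → ℕ
batchPos [] p = 0
batchPos (a ∷ α) p with p <? a
... | yes _ = p
... | no _ = batchPos α (p ∸ a)

batchPos-offset : ∀ {r} (α : Vec ℕ r) i t → t < lookup α i → batchPos α (offset α i + t) ≡ t
batchPos-offset (a ∷ α) fzero t t<a with t <? a
... | yes _ = refl
... | no t≮a = ⊥-elim (t≮a t<a)
batchPos-offset (a ∷ α) (fsuc i) t t<α with a + offset α i + t <? a
... | yes <a = ⊥-elim (<⇒≱ <a (≤-trans (m≤m+n a (offset α i)) (m≤m+n _ t)))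
... | no _ = trans (cong (batchPos α) (trans (cong (_∸ a) (+-assoc a (offset α i) t)) (m+n∸m≡n a _)))
                   (batchPos-offset α i t t<α)

batch-decomposition : ∀ {r} (α : Vec ℕ r) p → p < sum α →
  Σ (Fin r) λ i → Σ ℕ λ t → t < lookup α i × p ≡ offset α i + t
batch-decomposition (a ∷ α) p p<n with p <? a
... | yes p<a = fzero , p , p<a , refl
... | no p≮a =
  let a≤p = ≮⇒≥ p≮a
      (i , t , t<α , p-a≡) = batch-decomposition α (p ∸ a)
        (+-cancelˡ-< a (p ∸ a) (sum α) (subst (_< a + sum α) (sym (m+[n∸m]≡n a≤p)) p<n))
  in fsuc i , t , t<α , trans (sym (m+[n∸m]≡n a≤p)) (trans (cong (a +_) p-a≡) (sym (+-assoc a (offset α i) t)))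

batchPos-≤ : ∀ {r} (α : Vec ℕ r) p → batchPos α p ≤ p
batchPos-≤ [] p = z≤n
batchPos-≤ (a ∷ α) p with p <? a
... | yes _ = ≤-refl
... | no _ = ≤-trans (batchPos-≤ α (p ∸ a)) (m∸n≤m p a)

batchPos-zero : ∀ {r} (α : Vec ℕ r) → batchPos α 0 ≡ 0
batchPos-zero α = n≤0⇒n≡0 (batchPos-≤ α 0)

batchPos-suc : ∀ {r} (α : Vec ℕ r) p → batchPos α (suc p) ≤ suc (batchPos α p)
batchPos-suc [] p = z≤n
batchPos-suc (a ∷ α) p with suc p <? a | p <? a
... | yes _ | yes _ = ≤-refl
... | yes sp<a | no p≮a = ⊥-elim (p≮a (<-trans (n<1+n p) sp<a))
... | no _ | yes p<a =
  ≤-trans (≤-reflexive (trans (cong (batchPos α) (m≤n⇒m∸n≡0 p<a)) (batchPos-zero α))) z≤n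
... | no _ | no p≮a =
  subst (λ x → batchPos α x ≤ suc (batchPos α (p ∸ a))) (sym (+-∸-assoc 1 (≮⇒≥ p≮a))) (batchPos-suc α (p ∸ a))

module Batches {r} (α : Vec ℕ r) where

  inBatch-pos : ∀ {i} {p : Fin (sum α)} → InBatch α i p →
                toℕ p ≡ offset α i + batchPos α (toℕ p) × batchPos α (toℕ p) < lookup α i
  inBatch-pos {i} {p} (s≤s off≤p , p<end) = p≡ , subst (_< lookup α i) (sym pos≡) t<α
    where
    t = toℕ p ∸ offset α i
    p≡off+t : toℕ p ≡ offset α i + t
    p≡off+t = sym (m+[n∸m]≡n off≤p)
    t<α : t < lookup α i
    t<α = +-cancelˡ-< (offset α i) t (lookup α i) (subst (_< offset α i + lookup α i) p≡off+t p<end)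
    pos≡ : batchPos α (toℕ p) ≡ t
    pos≡ = trans (cong (batchPos α) p≡off+t) (batchPos-offset α i t t<α)
    p≡ : toℕ p ≡ offset α i + batchPos α (toℕ p)
    p≡ = trans p≡off+t (cong (offset α i +_) (sym pos≡))

  batchOf : (p : Fin (sum α)) → Σ (Fin r) λ i → InBatch α i p
  batchOf p with batch-decomposition α (toℕ p) (toℕ<n p)
  ... | i , t , t<α , p≡ =
    i , s≤s (subst (offset α i ≤_) (sym p≡) (m≤m+n _ t)) ,
    subst (λ x → suc x ≤ offset α i + lookup α i) (sym p≡) (+-monoʳ-< (offset α i) t<α)

  sameBatch⇔ : (p p' : Fin (sum α)) → toℕ p' < toℕ p →
    (Σ (Fin r) λ i → InBatch α i p × InBatch α i p') ⇔ (toℕ p ≤ toℕ p' + batchPos α (toℕ p))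
  sameBatch⇔ p p' p'<p = mk⇔ to from
    where
    to : (Σ (Fin r) λ i → InBatch α i p × InBatch α i p') → toℕ p ≤ toℕ p' + batchPos α (toℕ p)
    to (i , inP , (s≤s off≤p' , _)) =
      subst (_≤ toℕ p' + batchPos α (toℕ p)) (sym (proj₁ (inBatch-pos inP))) (+-monoˡ-≤ _ off≤p')
    from : toℕ p ≤ toℕ p' + batchPos α (toℕ p) → Σ (Fin r) λ i → InBatch α i p × InBatch α i p'
    from p≤ with batchOf p
    ... | i , inP@(_ , p<end) = i , inP , s≤s off≤p' , ≤-trans (<⇒≤ (s≤s p'<p)) p<end
      where
      off≤p' : offset α i ≤ toℕ p'
      off≤p' = +-cancelʳ-≤ (batchPos α (toℕ p)) _ _
                 (subst (_≤ toℕ p' + batchPos α (toℕ p)) (proj₁ (inBatch-pos inP)) p≤)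

  BatchCondition : ℕ → Monomial (sum α) → Set
  BatchCondition k m = ∀ (i : Fin r) (j : ℕ) (p : Fin (sum α)) → 1 ≤ j → j ≤ lookup α i →
                       suc (toℕ p) ≡ offset α i + j → ¬ powDivides p (k ∸ j + 1) m

  batchCondition⇔bounds : ∀ k → (∀ i → lookup α i ≤ k) → (m : Monomial (sum α)) →
    BatchCondition k m ⇔ (∀ p → lookup m p < k ∸ batchPos α (toℕ p))
  batchCondition⇔bounds k α≤k m = mk⇔ to from
    where
    k∸t : ∀ {i} t → t < lookup α i → k ∸ suc t + 1 ≡ k ∸ t
    k∸t {i} t t<α = trans (+-comm _ 1) (sym (+-∸-assoc 1 (<-≤-trans t<α (α≤k i))))
    to : BatchCondition k m → ∀ p → lookup m p < k ∸ batchPos α (toℕ p)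
    to condition p with batchOf p
    ... | i , inP with inBatch-pos inP
    ...   | p≡ , t<α = subst (lookup m p <_) (k∸t _ t<α)
              (≰⇒> (condition i (suc (batchPos α (toℕ p))) p (s≤s z≤n) t<α
                      (trans (cong suc p≡) (sym (+-suc (offset α i) _)))))
    from : (∀ p → lookup m p < k ∸ batchPos α (toℕ p)) → BatchCondition k m
    from bounds i (suc t) p _ t<α sp≡ divides = <⇒≱ (bounds p) (begin
      k ∸ batchPos α (toℕ p)   ≡⟨ cong (λ x → k ∸ batchPos α x) p≡ ⟩
      k ∸ batchPos α (offset α i + t) ≡⟨ cong (k ∸_) (batchPos-offset α i t t<α) ⟩
      k ∸ t                    ≡⟨ k∸t t t<α ⟨
      k ∸ suc t + 1            ≤⟨ divides ⟩
      lookup m p               ∎)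
      where
      open ≤-Reasoning
      p≡ : toℕ p ≡ offset α i + t
      p≡ = suc-injective (trans sp≡ (+-suc (offset α i) t))

opposite-sum : ∀ {n} (q : Fin n) → toℕ (opposite q) + suc (toℕ q) ≡ n
opposite-sum q = trans (cong (_+ suc (toℕ q)) (opposite-prop q)) (m∸n+n≡m (toℕ<n q))

opposite-next : ∀ {n} (q q' : Fin n) → toℕ q' ≡ suc (toℕ q) → toℕ (opposite q) ≡ suc (toℕ (opposite q'))
opposite-next {n} q q' q'≡ = +-cancelʳ-≡ (suc (toℕ q)) _ _ (begin
  toℕ (opposite q) + suc (toℕ q)         ≡⟨ opposite-sum q ⟩
  n                                     ≡⟨ opposite-sum q' ⟨
  toℕ (opposite q') + suc (toℕ q')       ≡⟨ cong (λ x → toℕ (opposite q') + suc x) q'≡ ⟩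
  toℕ (opposite q') + suc (suc (toℕ q))  ≡⟨ +-suc _ (suc (toℕ q)) ⟩
  suc (toℕ (opposite q')) + suc (toℕ q)  ∎)
  where open ≡-Reasoning

opposite-< : ∀ {n} (q q' : Fin n) → toℕ q < toℕ q' → toℕ (opposite q') < toℕ (opposite q)
opposite-< q q' q<q' =
  subst₂ _<_ (sym (opposite-prop q')) (sym (opposite-prop q)) (∸-monoʳ-< (s≤s q<q') (toℕ<n q'))

exchange-≤ : ∀ a b c d e → a + b ≡ c + d → d ≤ b + e → a ≤ c + e
exchange-≤ a b c d e sums d≤ = +-cancelʳ-≤ b a (c + e) (begin
  a + b        ≡⟨ sums ⟩
  c + d        ≤⟨ +-monoʳ-≤ c d≤ ⟩
  c + (b + e)  ≡⟨ cong (c +_) (+-comm b e) ⟩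
  c + (e + b)  ≡⟨ +-assoc c e b ⟨
  c + e + b    ∎)
  where open ≤-Reasoning

mirrored-gap⇔ : ∀ {n} (q q' : Fin n) d → toℕ q' ≤ toℕ q + d ⇔ toℕ (opposite q) ≤ toℕ (opposite q') + d
mirrored-gap⇔ q q' d = mk⇔
  (λ q'≤ → exchange-≤ _ _ _ _ d (trans (opposite-sum q) (sym (opposite-sum q'))) (s≤s q'≤))
  (λ p≤ → ≤-pred (exchange-≤ (suc (toℕ q')) (toℕ (opposite q')) (suc (toℕ q)) (toℕ (opposite q)) d
                    (trans (+-comm _ (toℕ (opposite q'))) (trans (opposite-sum q')
                      (trans (sym (opposite-sum q)) (+-comm (toℕ (opposite q)) _)))) p≤))

-- The word 1 2 ⋯ n read backwards, each letter with the window of the letters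
-- preceding it in its batch.
module MirroredWord (k : ℕ) {r} (α : Vec ℕ r) (α≤k : ∀ i → lookup α i ≤ k) where

  open Windowed k
  open Batches α

  n = sum α

  windows : Vec ℕ n
  windows = tabulate (λ q → batchPos α (toℕ (opposite q)))

  lookup-windows : ∀ q → lookup windows q ≡ batchPos α (toℕ (opposite q))
  lookup-windows q = lookup∘tabulate _ q

  batchPos<k : ∀ (p : Fin n) → batchPos α (toℕ p) < k
  batchPos<k p = let (i , inP) = batchOf p in <-≤-trans (proj₂ (inBatch-pos inP)) (α≤k i)

  admissible-windows : Admissible windows
  admissible-windows = admissible-tabulate _
    (λ q → batchPos-≤ α (toℕ (opposite q)))
    (λ q → batchPos<k (opposite q))
    (λ q q' q'≡ → subst (λ p → batchPos α p ≤ suc (batchPos α (toℕ (opposite q'))))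
                        (sym (opposite-next q q' q'≡)) (batchPos-suc α (toℕ (opposite q'))))

  bounds⇔mirrored : (m : Monomial n) →
    (∀ p → lookup m p < k ∸ batchPos α (toℕ p)) ⇔ mirror m <ᵛ Vec.map (k ∸_) windows
  bounds⇔mirrored m = mk⇔
    (λ bounds q → subst₂ _<_ (sym (lookup-mirror m q)) (sym (bound-at q)) (bounds (opposite q)))
    (λ bounds p → subst₂ _<_ (lookup-mirror-opposite m p)
                    (trans (bound-at (opposite p)) (cong (λ x → k ∸ batchPos α (toℕ x)) (opposite-involutive p)))
                    (bounds (opposite p)))
    where
    bound-at : ∀ q → lookup (Vec.map (k ∸_) windows) q ≡ k ∸ batchPos α (toℕ (opposite q))
    bound-at q = trans (lookup-map q (k ∸_) windows) (cong (k ∸_) (lookup-windows q))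

  window⇔sameBatch : ∀ (q q' : Fin n) → toℕ q < toℕ q' →
    toℕ q' ≤ toℕ q + lookup windows q ⇔
    (Σ (Fin r) λ i → InBatch α i (opposite q) × InBatch α i (opposite q'))
  window⇔sameBatch q q' q<q' = mk⇔
    (λ q'≤ → Equivalence.from sameBatch (Equivalence.to (mirrored-gap⇔ q q' _)
               (subst (λ w → toℕ q' ≤ toℕ q + w) (lookup-windows q) q'≤)))
    (λ same → subst (λ w → toℕ q' ≤ toℕ q + w) (sym (lookup-windows q))
                (Equivalence.from (mirrored-gap⇔ q q' _) (Equivalence.to sameBatch same)))
    where
    sameBatch = sameBatch⇔ (opposite q) (opposite q') (opposite-< q q' q<q')

  BatchDistinct : Vec (Fin k) n → Set
  BatchDistinct f = ∀ (i : Fin r) (p p' : Fin n) → InBatch α i p → InBatch α i p' → p ≢ p' →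
                    lookup f p ≢ lookup f p'

  batchDistinct⇒respects : (f : Vec (Fin k) n) → BatchDistinct f → Respects windows (mirror f)
  batchDistinct⇒respects f distinct = Equivalence.from (Respects⇔distinct windows (mirror f))
    λ q q' q<q' q'≤ same →
      let (i , inP , inP') = Equivalence.to (window⇔sameBatch q q' q<q') q'≤
      in distinct i (opposite q) (opposite q') inP inP'
           (λ e → <⇒≢ (opposite-< q q' q<q') (cong toℕ (sym e)))
           (trans (sym (lookup-mirror f q)) (trans same (lookup-mirror f q')))

  respects⇒distinct-ordered : (f : Vec (Fin k) n) → Respects windows (mirror f) →
    ∀ i p p' → InBatch α i p → InBatch α i p' → toℕ p' < toℕ p → lookup f p ≢ lookup f p'
  respects⇒distinct-ordered f respects i p p' inP inP' p'<p same =
    Equivalence.to (Respects⇔distinct windows (mirror f)) respects (opposite p) (opposite p') q<q'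
      (Equivalence.from (window⇔sameBatch (opposite p) (opposite p') q<q')
        (i , subst (InBatch α i) (sym (opposite-involutive p)) inP ,
             subst (InBatch α i) (sym (opposite-involutive p')) inP'))
      (trans (lookup-mirror-opposite f p) (trans same (sym (lookup-mirror-opposite f p'))))
    where
    q<q' : toℕ (opposite p) < toℕ (opposite p')
    q<q' = opposite-< p' p p'<p

  respects⇒batchDistinct : (f : Vec (Fin k) n) → Respects windows (mirror f) → BatchDistinct f
  respects⇒batchDistinct f respects i p p' inP inP' p≢p' with <-cmp (toℕ p) (toℕ p')
  ... | tri< p<p' _ _ = λ same → respects⇒distinct-ordered f respects i p' p inP' inP p<p' (sym same)
  ... | tri≈ _ p≡p' _ = ⊥-elim (p≢p' (toℕ-injective p≡p'))
  ... | tri> _ _ p'<p = respects⇒distinct-ordered f respects i p p' inP inP' p'<p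

does-true : ∀ {A : Set} (a? : Dec A) → does a? ≡ true → A
does-true (yes a) _ = a

vec-ext : ∀ {A : Set} {n} (v w : Vec A n) → (∀ p → lookup v p ≡ lookup w p) → v ≡ w
vec-ext v w v≗w = trans (sym (tabulate∘lookup v)) (trans (tabulate-cong v≗w) (tabulate∘lookup w))

-- Ordered set partitions of [n] into k blocks are the surjective colourings
-- of [n] by k colours: letter p lies in block a iff it has colour a.
module Blocks (k n : ℕ) where

  Surjective : Vec (Fin k) n → Set
  Surjective f = ∀ a → Σ (Fin n) λ p → lookup f p ≡ a

  blocksOf : Vec (Fin k) n → OrderedSetPartition n k
  blocksOf f = tabulate (λ a → tabulate (λ p → does (lookup f p ≟ᶠ a)))

  blocksOf-entry : ∀ f a p → lookup (lookup (blocksOf f) a) p ≡ does (lookup f p ≟ᶠ a)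
  blocksOf-entry f a p = trans (cong (λ S → lookup S p) (lookup∘tabulate _ a)) (lookup∘tabulate _ p)

  ∈blocksOf⇔ : ∀ f a p → p ∈ₛ lookup (blocksOf f) a ⇔ lookup f p ≡ a
  ∈blocksOf⇔ f a p = mk⇔
    (λ p∈ → does-true (lookup f p ≟ᶠ a) (trans (sym (blocksOf-entry f a p)) ([]=⇒lookup p∈)))
    (λ fp≡a → lookup⇒[]= p _ (trans (blocksOf-entry f a p) (dec-true (lookup f p ≟ᶠ a) fp≡a)))

  blocksOf-injective : ∀ {f f'} → blocksOf f ≡ blocksOf f' → f ≡ f'
  blocksOf-injective {f} {f'} e = vec-ext f f' λ p → sym
    (Equivalence.to (∈blocksOf⇔ f' (lookup f p) p)
      (subst (λ B → p ∈ₛ lookup B (lookup f p)) e (Equivalence.from (∈blocksOf⇔ f (lookup f p) p) refl)))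

  blocksOf-isOSP : ∀ f → Surjective f → IsOSP (blocksOf f)
  blocksOf-isOSP f surjective =
    (λ a → let (p , fp≡a) = surjective a in p , Equivalence.from (∈blocksOf⇔ f a p) fp≡a) ,
    (λ a b a≢b (p , p∈) → let (p∈a , p∈b) = x∈p∩q⁻ _ _ p∈ in
       a≢b (trans (sym (Equivalence.to (∈blocksOf⇔ f a p) p∈a)) (Equivalence.to (∈blocksOf⇔ f b p) p∈b))) ,
    (λ p → lookup f p , Equivalence.from (∈blocksOf⇔ f (lookup f p) p) refl)

  module _ (B : OrderedSetPartition n k) (osp : IsOSP B) where

    private
      nonempty = proj₁ osp
      disjoint = proj₁ (proj₂ osp)
      covering = proj₂ (proj₂ osp)

    colouringOf : Vec (Fin k) n
    colouringOf = tabulate (λ p → proj₁ (covering p))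

    in-own-block : ∀ p → p ∈ₛ lookup B (lookup colouringOf p)
    in-own-block p = subst (λ a → p ∈ₛ lookup B a) (sym (lookup∘tabulate _ p)) (proj₂ (covering p))

    own-block-unique : ∀ p a → p ∈ₛ lookup B a → lookup colouringOf p ≡ a
    own-block-unique p a p∈a with lookup colouringOf p ≟ᶠ a
    ... | yes e = e
    ... | no ne = ⊥-elim (disjoint _ _ ne (p , x∈p∩q⁺ (in-own-block p , p∈a)))

    blocksOf-colouringOf : blocksOf colouringOf ≡ B
    blocksOf-colouringOf = vec-ext _ B λ a → vec-ext _ _ λ p →
      trans (blocksOf-entry colouringOf a p) (sym (entry a p))
      where
      entry : ∀ a p → lookup (lookup B a) p ≡ does (lookup colouringOf p ≟ᶠ a)
      entry a p with lookup colouringOf p ≟ᶠ a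
      ... | yes refl = []=⇒lookup (in-own-block p)
      ... | no ne with lookup (lookup B a) p in p∈?
      ...   | true = ⊥-elim (ne (own-block-unique p a (lookup⇒[]= p _ p∈?)))
      ...   | false = refl

    colouringOf-surjective : Surjective colouringOf
    colouringOf-surjective a = let (p , p∈a) = nonempty a in p , own-block-unique p a p∈a

module Count (k : ℕ) {r} (α : Vec ℕ r) (α≤k : ∀ i → lookup α i ≤ k) where

  open Colours k
  open Windowed k
  open MirroredWord k α α≤k
  open Blocks k n
  open Batches α using (batchCondition⇔bounds)

  surjective⇔missing : (f : Vec (Fin k) n) → Surjective f ⇔ missing (toList (mirror f)) ≤ 0
  surjective⇔missing f = mk⇔ to from
    where
    to : Surjective f → missing (toList (mirror f)) ≤ 0
    to surjective = ≤-reflexive (all⇒missing≡0 _ occurs)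
      where
      occurs : ∀ a → a ∈ toList (mirror f)
      occurs a with surjective a
      ... | p , fp≡a = subst (_∈ toList (mirror f)) (trans (lookup-mirror-opposite f p) fp≡a)
                             (lookup∈toList (mirror f) (opposite p))
    from : missing (toList (mirror f)) ≤ 0 → Surjective f
    from none a with ∈toList⇒lookup (mirror f) (missing≤0⇒all _ none a)
    ... | q , e = opposite q , trans (sym (lookup-mirror f q)) e

  BlockBatchCondition : OrderedSetPartition n k → Set
  BlockBatchCondition B = ∀ (i : Fin r) (p q : Fin n) → InBatch α i p → InBatch α i q → p ≢ q →
                          ∀ (a : Fin k) → ¬ (p ∈ₛ lookup B a × q ∈ₛ lookup B a)

  blockBatch⇔batchDistinct : ∀ f → BlockBatchCondition (blocksOf f) ⇔ BatchDistinct f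
  blockBatch⇔batchDistinct f = mk⇔
    (λ condition i p q inP inQ p≢q fp≡fq → condition i p q inP inQ p≢q (lookup f p)
       (Equivalence.from (∈blocksOf⇔ f _ p) refl , Equivalence.from (∈blocksOf⇔ f _ q) (sym fp≡fq)))
    (λ distinct i p q inP inQ p≢q a (p∈a , q∈a) → distinct i p q inP inQ p≢q
       (trans (Equivalence.to (∈blocksOf⇔ f a p) p∈a) (sym (Equivalence.to (∈blocksOf⇔ f a q) q∈a))))

  surjectiveColourings : List (Vec (Fin k) n)
  surjectiveColourings = filter (missesAtMost 0) (colourings windows)

  ∈surjectiveColourings⇔ : ∀ f → mirror f ∈ surjectiveColourings ⇔ (Surjective f × BatchDistinct f)
  ∈surjectiveColourings⇔ f = mk⇔
    (λ f∈ → let (respects , none) = ∈-filter⁻ (missesAtMost 0) {xs = colourings windows} f∈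
            in Equivalence.from (surjective⇔missing f) none ,
               respects⇒batchDistinct f (∈-colourings⁻ windows respects))
    (λ (surjective , distinct) → ∈-filter⁺ (missesAtMost 0)
       (∈-colourings⁺ windows (batchDistinct⇒respects f distinct))
       (Equivalence.to (surjective⇔missing f) surjective))

  partitions : List (OrderedSetPartition n k)
  partitions = map (blocksOf ∘ mirror) surjectiveColourings

  unique-partitions : Unique partitions
  unique-partitions = map⁺ (mirror-injective ∘ blocksOf-injective) (filter⁺ _ (unique-colourings windows))

  ∈partitions⇔ : ∀ B → B ∈ partitions ⇔ IsOP α n k B
  ∈partitions⇔ B = mk⇔ to from
    where
    to : B ∈ partitions → IsOP α n k B
    to B∈ with ∈-map⁻ _ B∈
    ... | g , g∈ , refl =
      let (surjective , distinct) = Equivalence.to (∈surjectiveColourings⇔ (mirror g))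
                                      (subst (_∈ surjectiveColourings) (sym (mirror-involutive g)) g∈)
      in blocksOf-isOSP (mirror g) surjective ,
         Equivalence.from (blockBatch⇔batchDistinct (mirror g)) distinct
    from : IsOP α n k B → B ∈ partitions
    from (osp , condition) =
      subst (_∈ partitions) (trans (cong blocksOf (mirror-involutive f)) B≡)
        (∈-map⁺ (blocksOf ∘ mirror) (Equivalence.from (∈surjectiveColourings⇔ f)
          (colouringOf-surjective B osp ,
           Equivalence.to (blockBatch⇔batchDistinct f) (subst BlockBatchCondition (sym B≡) condition))))
      where
      f = colouringOf B osp
      B≡ = blocksOf-colouringOf B osp

  bounds : Vec ℕ n
  bounds = Vec.map (k ∸_) windows

  nonSkip⇔mirror : k ≤ n → ∀ m → NonSkip α n k m ⇔ (mirror m <ᵛ bounds × k ≤ runCounter 0 (mirror m))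
  nonSkip⇔mirror k≤n m = mk⇔
    (λ (noSkip , batchCondition) →
       Equivalence.to (bounds⇔mirrored m) (Equivalence.to (batchCondition⇔bounds k α≤k m) batchCondition) ,
       Equivalence.to (noSkip⇔reaches k m k≤n) noSkip)
    (λ (bounded , reaches) →
       Equivalence.from (noSkip⇔reaches k m k≤n) reaches ,
       Equivalence.from (batchCondition⇔bounds k α≤k m) (Equivalence.from (bounds⇔mirrored m) bounded))

  monomials : List (Monomial n)
  monomials = map mirror (reaching k bounds 0)

  unique-monomials : Unique monomials
  unique-monomials = map⁺ mirror-injective (unique-reaching k bounds 0)

  ∈monomials⇔ : k ≤ n → ∀ m → m ∈ monomials ⇔ NonSkip α n k m
  ∈monomials⇔ k≤n m = mk⇔ to from
    where
    to : m ∈ monomials → NonSkip α n k m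
    to m∈ with ∈-map⁻ _ m∈
    ... | b , b∈ , refl = Equivalence.from (nonSkip⇔mirror k≤n (mirror b))
      (subst (λ h → h <ᵛ bounds × k ≤ runCounter 0 h) (sym (mirror-involutive b)) (∈-reaching⁻ k bounds 0 b∈))
    from : NonSkip α n k m → m ∈ monomials
    from nonSkip = let (bounded , reaches) = Equivalence.to (nonSkip⇔mirror k≤n m) nonSkip
                   in subst (_∈ monomials) (mirror-involutive m)
                        (∈-map⁺ mirror (∈-reaching⁺ k bounds 0 {mirror m} bounded reaches))

  cardinality : ℕ
  cardinality = #missing≤ windows 0

  length-monomials : length monomials ≡ cardinality
  length-monomials = trans (length-map mirror (reaching k bounds 0)) (reaching≡colourings windows admissible-windows 0)

  length-partitions : length partitions ≡ cardinality
  length-partitions = length-map (blocksOf ∘ mirror) surjectiveColourings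

-- The theorem.
lemma3p9 : (n k r : ℕ) (α : Vec ℕ r) → 0 < k → k ≤ n →
    (∀ (i : Fin r) → 1 ≤ lookup α i × lookup α i ≤ k) → sum α ≡ n →
    Σ ℕ λ c → HasCard (NonSkip α n k) c × HasCard (IsOP α n k) c
lemma3p9 _ k r α _ k≤n sizes refl =
  cardinality ,
  (monomials , unique-monomials , ∈monomials⇔ k≤n , length-monomials) ,
  (partitions , unique-partitions , ∈partitions⇔ , length-partitions)
  where open Count k α (proj₂ ∘ sizes)
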